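{- Let $G$ be a graph with no isolated vertices, let $G_0,G_1,\dots,G_m$ be a chain decomposition of $G$ rooted at $r$, and let $v\in V(G)$ with $v\ne r$. Then $v$ has degree at least $4$ in $G$.
   Context: Graphs are multigraphs (parallel edges and loops allowed; a loop adds $2$ to the degree; a loop is a cycle of length one and two parallel edges form a cycle of length two). Paths and cycles are simple. The degree of a vertex in a subgraph not containing it is $0$. An up chain of $G$ with respect to a pair of edge-disjoint subgraphs $(H,\overline{H})$ is a subgraph of $G$, edge-disjoint from $H$ and $\overline{H}$, which is either (i) a path with at least one edge such that every vertex is either $r$ or has degree at least two in $\overline{H}$, and each end is either $r$ or lies in $H$; or (ii) a cycle such that every vertex is either $r$ or has degree at least two in $\overline{H}$, and some vertex $v$ of it is either $r$ or has degree at least two in $H$ ($v$ is regarded as both ends, all other vertices internal). A down chain with respect to $(H,\overline{H})$ is an up chain with respect to $(\overline{H},H)$. A one-way chain with respect to $(H,\overline{H})$ is the subgraph induced by a single edge $e\notin E(H)\cup E(\overline{H})$ with ends $u$ (tail) and $v$ (head) such that $u$ is $r$ or has degree at least two in $H$, and $v$ is $r$ or has degree at least two in $\overline{H}$. A sequence $G_0,\dots,G_m$ of subgraphs of $G$ is a chain decomposition of $G$ rooted at $r\in V(G)$ if, writing $H_i=G_0\cup\cdots\cup G_{i-1}$ and $\overline{H_i}=G_{i+1}\cup\cdots\cup G_m$ (so $H_0$ and $\overline{H_m}$ are null), the sets $E(G_0),\dots,E(G_m)$ partition $E(G)$ and each $G_i$ is an up chain, a down chain, or a one-way chain with respect to $(H_i,\overline{H_i})$.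 -}

module Defs where

open import Data.Nat using (ℕ; zero; suc; _+_; _≤_; _<ᵇ_)
open import Data.Fin using (Fin; zero; suc; toℕ; fromℕ; inject₁)
open import Data.Fin.Properties using (_≟_)
open import Data.Bool using (Bool; true; false; if_then_else_)
open import Data.Maybe using (Maybe; just; nothing; fromMaybe)
import Data.Maybe as Maybe
open import Data.List using (tabulate)
open import Data.Nat.ListAction using (sum)
open import Data.Product using (Σ; ∃; ∃-syntax; _×_; _,_; proj₁; proj₂)
open import Data.Sum using (_⊎_)
open import Relation.Nullary.Decidable using (⌊_⌋)
open import Relation.Binary.PropositionalEquality using (_≡_)
open import Function.Definitions using (Injective)
open import Function.Bundles using (_⇔_)

-- A finite multigraph: vertices Fin n, edges Fin k, each edge has two ends
-- (equal ends = loop).  Parallel edges are distinct edge indices.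
record Graph : Set where
  field
    n    : ℕ
    k    : ℕ
    ends : Fin k → Fin n × Fin n

open Graph public

V : Graph → Set
V G = Fin (n G)

E : Graph → Set
E G = Fin (k G)

Joins : (G : Graph) → E G → V G → V G → Set
Joins G e x y = (ends G e ≡ (x , y)) ⊎ (ends G e ≡ (y , x))

-- number of ends of e equal to v (a loop at v contributes 2)
mult : (G : Graph) → E G → V G → ℕ
mult G e v =
  (if ⌊ proj₁ (ends G e) ≟ v ⌋ then 1 else 0) +
  (if ⌊ proj₂ (ends G e) ≟ v ⌋ then 1 else 0)

-- A subgraph whose vertex set is the set of ends of its edges is determined
-- by its edge set, given as a Boolean predicate on E G.
EdgeSet : Graph → Set
EdgeSet G = E G → Bool

deg : (G : Graph) → EdgeSet G → V G → ℕ
deg G S v = sum (tabulate (λ e → if S e then mult G e v else 0))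

allEdges : (G : Graph) → EdgeSet G
allEdges G _ = true

InSub : (G : Graph) → EdgeSet G → V G → Set
InSub G S v = ∃[ e ] ((S e ≡ true) × (∃[ y ] Joins G e v y))

NoIsolated : Graph → Set
NoIsolated G = (v : V G) → ∃[ e ] ∃[ y ] Joins G e v y

RorDeg2 : (G : Graph) → V G → EdgeSet G → V G → Set
RorDeg2 G r S v = (v ≡ r) ⊎ (2 ≤ deg G S v)

record PathOf (G : Graph) (P : EdgeSet G) : Set where
  field
    len    : ℕ
    vs     : Fin (suc (suc len)) → V G
    es     : Fin (suc len) → E G
    vsInj  : Injective _≡_ _≡_ vs
    esInj  : Injective _≡_ _≡_ es
    joins  : (j : Fin (suc len)) → Joins G (es j) (vs (inject₁ j)) (vs (suc j))
    exact  : (e : E G) → (P e ≡ true) ⇔ (∃[ j ] es j ≡ e)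

step : ∀ {l} → Fin l → Maybe (Fin l)
step {suc zero} zero = nothing
step {suc (suc l)} zero = just (suc zero)
step {suc (suc l)} (suc j) = Maybe.map suc (step j)

next : ∀ {l} → Fin (suc l) → Fin (suc l)
next j = fromMaybe zero (step j)

-- The subgraph with edge set P is a cycle of length l+1 ≥ 1:
-- distinct vertices cv 0 … cv l, distinct edges ce 0 … ce l,
-- ce j joining cv j and cv (j+1 mod l+1), and P is exactly {ce j}.
-- (Length 1 = loop, length 2 = two parallel edges.)
record CycleOf (G : Graph) (P : EdgeSet G) : Set where
  field
    len    : ℕ
    cv     : Fin (suc len) → V G
    ce     : Fin (suc len) → E G
    cvInj  : Injective _≡_ _≡_ cv
    ceInj  : Injective _≡_ _≡_ ce
    joins  : (j : Fin (suc len)) → Joins G (ce j) (cv j) (cv (next j))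
    exact  : (e : E G) → (P e ≡ true) ⇔ (∃[ j ] ce j ≡ e)

-- Up chain with edge set P w.r.t. (H , Hb), rooted at r.
-- (Edge-disjointness from H and Hb is guaranteed by the partition below.)
UpChain : (G : Graph) → V G → EdgeSet G → EdgeSet G → EdgeSet G → Set
UpChain G r H Hb P =
  (Σ (PathOf G P) λ p → let open PathOf p in
      ((j : Fin (suc (suc len))) → RorDeg2 G r Hb (vs j))
    × ((vs zero ≡ r) ⊎ InSub G H (vs zero))
    × ((vs (fromℕ (suc len)) ≡ r) ⊎ InSub G H (vs (fromℕ (suc len)))))
  ⊎
  (Σ (CycleOf G P) λ c → let open CycleOf c in
      ((j : Fin (suc len)) → RorDeg2 G r Hb (cv j))
    × (∃[ j ] RorDeg2 G r H (cv j)))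

DownChain : (G : Graph) → V G → EdgeSet G → EdgeSet G → EdgeSet G → Set
DownChain G r H Hb P = UpChain G r Hb H P

OneWayChain : (G : Graph) → V G → EdgeSet G → EdgeSet G → EdgeSet G → Set
OneWayChain G r H Hb P =
  ∃[ e ] ∃[ u ] ∃[ v ]
      ((f : E G) → (P f ≡ true) ⇔ (e ≡ f))
    × Joins G e u v
    × RorDeg2 G r H u
    × RorDeg2 G r Hb v

-- A chain decomposition G_0,…,G_m rooted at r, given by the edge labelling
-- c : E G → Fin (m+1) (c e = i iff e ∈ E(G_i)); the E(G_i) partition E(G).
Gi : (G : Graph) {m : ℕ} → (E G → Fin (suc m)) → Fin (suc m) → EdgeSet G
Gi G c i e = ⌊ c e ≟ i ⌋

Hbelow : (G : Graph) {m : ℕ} → (E G → Fin (suc m)) → Fin (suc m) → EdgeSet G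
Hbelow G c i e = toℕ (c e) <ᵇ toℕ i

Habove : (G : Graph) {m : ℕ} → (E G → Fin (suc m)) → Fin (suc m) → EdgeSet G
Habove G c i e = toℕ i <ᵇ toℕ (c e)

IsChainDecomposition : (G : Graph) (r : V G) (m : ℕ) → (E G → Fin (suc m)) → Set
IsChainDecomposition G r m c =
  (i : Fin (suc m)) →
      UpChain     G r (Hbelow G c i) (Habove G c i) (Gi G c i)
    ⊎ DownChain   G r (Hbelow G c i) (Habove G c i) (Gi G c i)
    ⊎ OneWayChain G r (Hbelow G c i) (Habove G c i) (Gi G c i)

-- Suppose v ≠ r has degree at most 3. On an up or down chain G_i, v gets degree at least 2
-- from the side condition in H̄_i (resp. H_i) and at least 2 more from G_i together with H_i
-- (resp. H̄_i), since an end of a path lies in the other side; so every chain at v is one-way,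
-- with v as its tail (degree ≥ 2 in H_i) or its head (degree ≥ 2 in H̄_i). By induction on i,
-- v has degree at most 1 in H_i: a chain G_i at v cannot have v as tail, so v is its head,
-- and then two of the at most three edge-ends at v lie in H̄_i, leaving at most one in H_(i+1).
-- In the end v has degree at most 1 in G, yet the chain through an edge at v forces degree 2.

module Submission where

open import Defs
open import Data.Nat using (ℕ; zero; suc; _+_; _≤_; _<ᵇ_; z≤n; s≤s; s≤s⁻¹; _≤?_)
open import Data.Nat.Properties
  using (≤-refl; ≤-trans; ≤-reflexive; +-mono-≤; +-monoʳ-≤; +-cancelʳ-≤; +-comm; +-assoc;
         +-identityʳ; +-commutativeSemigroup; <⇒<ᵇ; m≤m+n; m≤n+m; ≮⇒≥; n≤0⇒n≡0; <⇒≱; <⇒≤)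
open import Data.Fin using (Fin; zero; suc; toℕ; fromℕ; fromℕ<; inject₁)
open import Data.Fin.Properties using (_≟_; suc-injective; toℕ<n; toℕ-fromℕ<)
import Data.Maybe as Maybe
open import Data.Bool using (Bool; true; false; not; if_then_else_)
open import Data.Bool.Properties using (T-≡)
open import Data.List using (tabulate)
open import Data.List.Properties using (tabulate-cong)
open import Data.Nat.ListAction using (sum)
open import Data.Product using (∃-syntax; _×_; _,_)
open import Data.Sum using (_⊎_; inj₁; inj₂; [_,_])
open import Data.Empty using (⊥)
open import Function using (_∘_; id)
open import Function.Bundles using (Equivalence)
open import Relation.Nullary using (does; yes; no; contradiction)
open import Relation.Nullary.Decidable using (⌊_⌋; dec-true; isYes≗does)
open import Relation.Binary.PropositionalEquality
  using (_≡_; _≢_; _≗_; refl; sym; trans; cong; cong₂; subst; subst₂; module ≡-Reasoning)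
open import Algebra.Properties.CommutativeSemigroup +-commutativeSemigroup
  using () renaming (interchange to +-interchange)

∑ : ∀ {k} → (Fin k → ℕ) → ℕ
∑ f = sum (tabulate f)

∑-cong : ∀ {k} {f g : Fin k → ℕ} → f ≗ g → ∑ f ≡ ∑ g
∑-cong f≗g = cong sum (tabulate-cong f≗g)

∑-zero : ∀ k → ∑ {k} (λ _ → 0) ≡ 0
∑-zero zero = refl
∑-zero (suc k) = ∑-zero k

∑-distrib-+ : ∀ {k} (f g : Fin k → ℕ) → ∑ (λ i → f i + g i) ≡ ∑ f + ∑ g
∑-distrib-+ {zero} f g = refl
∑-distrib-+ {suc k} f g = begin
  (f zero + g zero) + ∑ (λ i → f (suc i) + g (suc i))
    ≡⟨ cong ((f zero + g zero) +_) (∑-distrib-+ (f ∘ suc) (g ∘ suc)) ⟩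
  (f zero + g zero) + (∑ (f ∘ suc) + ∑ (g ∘ suc))
    ≡⟨ +-interchange (f zero) (g zero) (∑ (f ∘ suc)) (∑ (g ∘ suc)) ⟩
  (f zero + ∑ (f ∘ suc)) + (g zero + ∑ (g ∘ suc)) ∎
  where open ≡-Reasoning

∑-≥-term : ∀ {k} (f : Fin k → ℕ) (i : Fin k) → f i ≤ ∑ f
∑-≥-term f zero = m≤m+n (f zero) _
∑-≥-term f (suc i) = ≤-trans (∑-≥-term (f ∘ suc) i) (m≤n+m _ (f zero))

∑-≥-two-terms : ∀ {k} (f : Fin k → ℕ) {i j : Fin k} → i ≢ j → f i + f j ≤ ∑ f
∑-≥-two-terms f {zero} {zero} i≢j = contradiction refl i≢j
∑-≥-two-terms f {zero} {suc j} _ = +-monoʳ-≤ (f zero) (∑-≥-term (f ∘ suc) j)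
∑-≥-two-terms f {suc i} {zero} _ =
  ≤-trans (≤-reflexive (+-comm (f (suc i)) (f zero))) (+-monoʳ-≤ (f zero) (∑-≥-term (f ∘ suc) i))
∑-≥-two-terms f {suc i} {suc j} i≢j =
  ≤-trans (∑-≥-two-terms (f ∘ suc) (i≢j ∘ cong suc)) (m≤n+m _ (f zero))

∑-positive : ∀ {k} (f : Fin k → ℕ) → 1 ≤ ∑ f → ∃[ i ] 1 ≤ f i
∑-positive {suc k} f 1≤∑ with f zero in eq
... | zero = let (i , 1≤fi) = ∑-positive (f ∘ suc) 1≤∑ in suc i , 1≤fi
... | suc _ = zero , subst (1 ≤_) (sym eq) (s≤s z≤n)

⌊⌋-refl : ∀ {n} (x : Fin n) → ⌊ x ≟ x ⌋ ≡ true
⌊⌋-refl x = trans (isYes≗does (x ≟ x)) (dec-true (x ≟ x) refl)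

select : Bool → ℕ → ℕ
select b n = if b then n else 0

module _ (G : Graph) where

  endIndicator : V G → V G → ℕ
  endIndicator x w = select ⌊ x ≟ w ⌋ 1

  endIndicator-self : ∀ x → endIndicator x x ≡ 1
  endIndicator-self x = cong (λ b → select b 1) (⌊⌋-refl x)

  mult-Joins : ∀ {e x y} → Joins G e x y → ∀ w → mult G e w ≡ endIndicator x w + endIndicator y w
  mult-Joins (inj₁ e≡xy) w = cong (λ (a , b) → endIndicator a w + endIndicator b w) e≡xy
  mult-Joins {x = x} {y} (inj₂ e≡yx) w =
    trans (cong (λ (a , b) → endIndicator a w + endIndicator b w) e≡yx)
          (+-comm (endIndicator y w) (endIndicator x w))

  Joins-sym : ∀ {e x y} → Joins G e x y → Joins G e y x
  Joins-sym = [ inj₂ , inj₁ ]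

  Joins⇒1≤mult : ∀ {e x y} → Joins G e x y → 1 ≤ mult G e x
  Joins⇒1≤mult {x = x} {y} J = subst (1 ≤_) (sym (mult-Joins J x))
    (subst (λ n → 1 ≤ n + endIndicator y x) (sym (endIndicator-self x)) (s≤s z≤n))

  Joins-loop⇒2≤mult : ∀ {e x} → Joins G e x x → 2 ≤ mult G e x
  Joins-loop⇒2≤mult {x = x} J = ≤-reflexive (sym (trans (mult-Joins J x)
    (cong₂ _+_ (endIndicator-self x) (endIndicator-self x))))

  1≤mult⇒end : ∀ {e x y w} → Joins G e x y → 1 ≤ mult G e w → w ≡ x ⊎ w ≡ y
  1≤mult⇒end {x = x} {y} {w} J 1≤mult with x ≟ w | y ≟ w | subst (1 ≤_) (mult-Joins J w) 1≤mult
  ... | yes x≡w | _ | _ = inj₁ (sym x≡w)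
  ... | no _ | yes y≡w | _ = inj₂ (sym y≡w)
  ... | no _ | no _ | ()

  mult≤deg : ∀ {S e} → S e ≡ true → ∀ w → mult G e w ≤ deg G S w
  mult≤deg {S} {e} Se w =
    subst (λ b → select b (mult G e w) ≤ deg G S w) Se (∑-≥-term (λ f → select (S f) (mult G f w)) e)

  mult+mult≤deg : ∀ {S e f} → e ≢ f → S e ≡ true → S f ≡ true → ∀ w →
                  mult G e w + mult G f w ≤ deg G S w
  mult+mult≤deg {S} {e} {f} e≢f Se Sf w =
    subst₂ (λ b c → select b (mult G e w) + select c (mult G f w) ≤ deg G S w) Se Sf
      (∑-≥-two-terms (λ g → select (S g) (mult G g w)) e≢f)

  deg-positive : ∀ {S w} → 1 ≤ deg G S w → ∃[ e ] S e ≡ true × 1 ≤ mult G e w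
  deg-positive {S} {w} 1≤deg with ∑-positive (λ g → select (S g) (mult G g w)) 1≤deg
  ... | e , 1≤sel with S e in Se
  ...   | true = e , Se , 1≤sel

  InSub⇒1≤deg : ∀ {S w} → InSub G S w → 1 ≤ deg G S w
  InSub⇒1≤deg (e , Se , _ , J) = ≤-trans (Joins⇒1≤mult J) (mult≤deg Se _)

inject₁≢suc : ∀ {n} (i : Fin n) → inject₁ i ≢ suc i
inject₁≢suc zero ()
inject₁≢suc (suc i) eq = inject₁≢suc i (suc-injective eq)

fromℕ⊎inject₁ : ∀ {n} (i : Fin (suc n)) → i ≡ fromℕ n ⊎ ∃[ j ] i ≡ inject₁ j
fromℕ⊎inject₁ {zero} zero = inj₁ refl
fromℕ⊎inject₁ {suc n} zero = inj₂ (zero , refl)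
fromℕ⊎inject₁ {suc n} (suc i) with fromℕ⊎inject₁ i
... | inj₁ refl = inj₁ refl
... | inj₂ (j , refl) = inj₂ (suc j , refl)

step-fromℕ : ∀ n → step (fromℕ n) ≡ Maybe.nothing
step-fromℕ zero = refl
step-fromℕ (suc n) = cong (Maybe.map suc) (step-fromℕ n)

step-inject₁ : ∀ {n} (i : Fin (suc n)) → step (inject₁ i) ≡ Maybe.just (suc i)
step-inject₁ zero = refl
step-inject₁ {suc n} (suc i) = cong (Maybe.map suc) (step-inject₁ i)

next-surjective : ∀ {n} (i : Fin (suc n)) → ∃[ j ] next j ≡ i
next-surjective {n} zero = fromℕ n , cong (Maybe.fromMaybe zero) (step-fromℕ n)
next-surjective {suc n} (suc i) = inject₁ i , cong (Maybe.fromMaybe zero) (step-inject₁ i)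

module _ {G : Graph} {P : EdgeSet G} (p : PathOf G P) where
  open PathOf p

  private
    es∈P : ∀ j → P (es j) ≡ true
    es∈P j = Equivalence.from (exact (es j)) (j , refl)

  path-vertex : ∀ {w} → 1 ≤ deg G P w → ∃[ q ] w ≡ vs q
  path-vertex 1≤deg with deg-positive G 1≤deg
  ... | e , Pe , 1≤mult with Equivalence.to (exact e) Pe
  ...   | j , refl with 1≤mult⇒end G (joins j) 1≤mult
  ...     | inj₁ w≡tail = inject₁ j , w≡tail
  ...     | inj₂ w≡head = suc j , w≡head

  path-vertex-1≤deg : ∀ q → 1 ≤ deg G P (vs q)
  path-vertex-1≤deg zero = ≤-trans (Joins⇒1≤mult G (joins zero)) (mult≤deg G (es∈P zero) _)
  path-vertex-1≤deg (suc j) =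
    ≤-trans (Joins⇒1≤mult G (Joins-sym G (joins j))) (mult≤deg G (es∈P j) _)

  path-interior-2≤deg : ∀ i → 2 ≤ deg G P (vs (suc (inject₁ i)))
  path-interior-2≤deg i =
    ≤-trans (+-mono-≤ (Joins⇒1≤mult G (Joins-sym G (joins (inject₁ i)))) (Joins⇒1≤mult G (joins (suc i))))
            (mult+mult≤deg G (inject₁≢suc i ∘ esInj) (es∈P _) (es∈P _) _)

module _ {G : Graph} {P : EdgeSet G} (c : CycleOf G P) where
  open CycleOf c

  private
    ce∈P : ∀ j → P (ce j) ≡ true
    ce∈P j = Equivalence.from (exact (ce j)) (j , refl)

  cycle-vertex : ∀ {w} → 1 ≤ deg G P w → ∃[ q ] w ≡ cv q
  cycle-vertex 1≤deg with deg-positive G 1≤deg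
  ... | e , Pe , 1≤mult with Equivalence.to (exact e) Pe
  ...   | j , refl with 1≤mult⇒end G (joins j) 1≤mult
  ...     | inj₁ w≡tail = j , w≡tail
  ...     | inj₂ w≡head = next j , w≡head

  private
    head-2≤deg : ∀ j → 2 ≤ deg G P (cv (next j))
    head-2≤deg j with j ≟ next j
    -- only a one-edge cycle, which is a loop
    ... | yes j≡next =
      ≤-trans (Joins-loop⇒2≤mult G (subst (λ i → Joins G (ce j) (cv i) (cv (next j))) j≡next (joins j)))
              (mult≤deg G (ce∈P j) _)
    ... | no j≢next =
      ≤-trans (+-mono-≤ (Joins⇒1≤mult G (Joins-sym G (joins j))) (Joins⇒1≤mult G (joins (next j))))
              (mult+mult≤deg G (j≢next ∘ ceInj) (ce∈P _) (ce∈P _) _)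

  cycle-vertex-2≤deg : ∀ q → 2 ≤ deg G P (cv q)
  cycle-vertex-2≤deg q with next-surjective q
  ... | j , refl = head-2≤deg j

module _ {G : Graph} {r : V G} where

  RorDeg2⇒2≤deg : ∀ {S w} → w ≢ r → RorDeg2 G r S w → 2 ≤ deg G S w
  RorDeg2⇒2≤deg w≢r = [ (λ w≡r → contradiction w≡r w≢r) , id ]

  end⇒1≤deg : ∀ {S w} → w ≢ r → (w ≡ r) ⊎ InSub G S w → 1 ≤ deg G S w
  end⇒1≤deg w≢r = [ (λ w≡r → contradiction w≡r w≢r) , InSub⇒1≤deg G ]

  upChain-4≤deg : ∀ {H Hb P w} → UpChain G r H Hb P → w ≢ r → 1 ≤ deg G P w →
                  4 ≤ deg G H w + deg G P w + deg G Hb w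
  upChain-4≤deg {H} {Hb} {P} (inj₁ (p , inner , start , end)) w≢r w∈P with path-vertex p w∈P
  ... | q , refl = vertex-4≤deg q w≢r
    where
    open PathOf p
    vertex-4≤deg : ∀ q → vs q ≢ r → 4 ≤ deg G H (vs q) + deg G P (vs q) + deg G Hb (vs q)
    vertex-4≤deg zero ≢r =
      +-mono-≤ (+-mono-≤ (end⇒1≤deg ≢r start) (path-vertex-1≤deg p zero))
               (RorDeg2⇒2≤deg ≢r (inner zero))
    vertex-4≤deg (suc j) ≢r with fromℕ⊎inject₁ j
    ... | inj₁ refl =
      +-mono-≤ (+-mono-≤ (end⇒1≤deg ≢r end) (path-vertex-1≤deg p (suc j)))
               (RorDeg2⇒2≤deg ≢r (inner (suc j)))
    ... | inj₂ (i , refl) =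
      +-mono-≤ (≤-trans (path-interior-2≤deg p i) (m≤n+m _ _)) (RorDeg2⇒2≤deg ≢r (inner (suc j)))
  upChain-4≤deg (inj₂ (c , inner , _)) w≢r w∈P with cycle-vertex c w∈P
  ... | q , refl =
    +-mono-≤ (≤-trans (cycle-vertex-2≤deg c q) (m≤n+m _ _)) (RorDeg2⇒2≤deg w≢r (inner q))

  oneWayChain-2≤deg : ∀ {H Hb P w} → OneWayChain G r H Hb P → w ≢ r → 1 ≤ deg G P w →
                      2 ≤ deg G H w ⊎ 2 ≤ deg G Hb w
  oneWayChain-2≤deg (e , tail , head , exact , J , Rtail , Rhead) w≢r w∈P with deg-positive G w∈P
  ... | f , Pf , 1≤mult with Equivalence.to (exact f) Pf
  ...   | refl with 1≤mult⇒end G J 1≤mult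
  ...     | inj₁ refl = inj₁ (RorDeg2⇒2≤deg w≢r Rtail)
  ...     | inj₂ refl = inj₂ (RorDeg2⇒2≤deg w≢r Rhead)

  chain-local-deg : ∀ {H Hb P w} →
    UpChain G r H Hb P ⊎ DownChain G r H Hb P ⊎ OneWayChain G r H Hb P → w ≢ r → 1 ≤ deg G P w →
    4 ≤ deg G H w + deg G P w + deg G Hb w ⊎ 2 ≤ deg G H w ⊎ 2 ≤ deg G Hb w
  chain-local-deg (inj₁ up) w≢r w∈P = inj₁ (upChain-4≤deg up w≢r w∈P)
  chain-local-deg {H} {Hb} {P} {w} (inj₂ (inj₁ down)) w≢r w∈P =
    inj₁ (subst (4 ≤_) (reverse₃ (deg G Hb w) (deg G P w) (deg G H w)) (upChain-4≤deg down w≢r w∈P))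
    where
    reverse₃ : ∀ a b c → a + b + c ≡ c + b + a
    reverse₃ a b c = trans (+-comm (a + b) c) (trans (cong (c +_) (+-comm a b)) (sym (+-assoc c b a)))
  chain-local-deg (inj₂ (inj₂ oneWay)) w≢r w∈P = inj₂ (oneWayChain-2≤deg oneWay w≢r w∈P)

data OneHot : Bool → Bool → Bool → Set where
  first  : OneHot true false false
  second : OneHot false true false
  third  : OneHot false false true

compare-one-hot : ∀ {n} (x i : Fin n) → OneHot (toℕ x <ᵇ toℕ i) ⌊ x ≟ i ⌋ (toℕ i <ᵇ toℕ x)
-- via does, because ⌊_⌋ (= isYes) does not compute through the map′ in suc x ≟ suc i
compare-one-hot x i =
  subst (λ b → OneHot (toℕ x <ᵇ toℕ i) b (toℕ i <ᵇ toℕ x)) (sym (isYes≗does (x ≟ i))) (compare x i)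
  where
  compare : ∀ {n} (x i : Fin n) → OneHot (toℕ x <ᵇ toℕ i) (does (x ≟ i)) (toℕ i <ᵇ toℕ x)
  compare zero zero = second
  compare zero (suc i) = first
  compare (suc x) zero = third
  compare (suc x) (suc i) = compare x i

<ᵇ-suc : ∀ a b → (a <ᵇ suc b) ≡ not (b <ᵇ a)
<ᵇ-suc zero b = refl
<ᵇ-suc (suc a) zero = refl
<ᵇ-suc (suc a) (suc b) = <ᵇ-suc a b

select-one-hot : ∀ {p q s} → OneHot p q s → ∀ n → select p n + select q n + select s n ≡ n
select-one-hot first n = trans (+-identityʳ (n + 0)) (+-identityʳ n)
select-one-hot second n = +-identityʳ n
select-one-hot third n = refl

select-not-one-hot : ∀ {p q s} → OneHot p q s → ∀ n → select (not s) n ≡ select p n + select q n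
select-not-one-hot first n = sym (+-identityʳ n)
select-not-one-hot second n = refl
select-not-one-hot third n = refl

module _ (G : Graph) {m : ℕ} (c : E G → Fin (suc m)) (w : V G) where

  -- the degree of w in G_0 ∪ … ∪ G_(t-1); degBelow (toℕ i) is definitionally deg G (Hbelow G c i) w
  degBelow : ℕ → ℕ
  degBelow t = deg G (λ e → toℕ (c e) <ᵇ t) w

  degBelow-zero : degBelow 0 ≡ 0
  degBelow-zero = ∑-zero (k G)

  degBelow-suc : ∀ i → degBelow (suc (toℕ i)) ≡ deg G (Hbelow G c i) w + deg G (Gi G c i) w
  degBelow-suc i = begin
    degBelow (suc (toℕ i))
      ≡⟨ ∑-cong (λ e → cong (λ b → select b (mult G e w)) (<ᵇ-suc (toℕ (c e)) (toℕ i))) ⟩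
    ∑ (λ e → select (not (above e)) (mult G e w))
      ≡⟨ ∑-cong (λ e → select-not-one-hot (compare-one-hot (c e) i) (mult G e w)) ⟩
    ∑ (λ e → select (below e) (mult G e w) + select (at e) (mult G e w))
      ≡⟨ ∑-distrib-+ (λ e → select (below e) (mult G e w)) (λ e → select (at e) (mult G e w)) ⟩
    deg G below w + deg G at w             ∎
    where
    open ≡-Reasoning
    below at above : EdgeSet G
    below = Hbelow G c i
    at = Gi G c i
    above = Habove G c i

  degBelow-all : degBelow (suc m) ≡ deg G (allEdges G) w
  degBelow-all =
    ∑-cong λ e → cong (λ b → select b (mult G e w)) (Equivalence.to T-≡ (<⇒<ᵇ (toℕ<n (c e))))

  deg-split : ∀ i → deg G (Hbelow G c i) w + deg G (Gi G c i) w + deg G (Habove G c i) w ≡ deg G (allEdges G) w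
  deg-split i = begin
    ∑ below + ∑ at + ∑ above
      ≡⟨ cong (_+ ∑ above) (∑-distrib-+ below at) ⟨
    ∑ (λ e → below e + at e) + ∑ above
      ≡⟨ ∑-distrib-+ _ above ⟨
    ∑ (λ e → below e + at e + above e)
      ≡⟨ ∑-cong (λ e → select-one-hot (compare-one-hot (c e) i) (mult G e w)) ⟩
    deg G (allEdges G) w ∎
    where
    open ≡-Reasoning
    below at above : E G → ℕ
    below e = select (Hbelow G c i e) (mult G e w)
    at e = select (Gi G c i e) (mult G e w)
    above e = select (Habove G c i e) (mult G e w)

module _ {G : Graph} {r : V G} {m : ℕ} {c : E G → Fin (suc m)} (isCD : IsChainDecomposition G r m c)
         {v : V G} (v≢r : v ≢ r) where

  private
    L A R : Fin (suc m) → ℕ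
    L i = deg G (Hbelow G c i) v
    A i = deg G (Gi G c i) v
    R i = deg G (Habove G c i) v

    D : ℕ
    D = deg G (allEdges G) v

  L≤D : ∀ i → L i ≤ D
  L≤D i = ≤-trans (≤-trans (m≤m+n (L i) (A i)) (m≤m+n _ (R i))) (≤-reflexive (deg-split G c v i))

  R≤D : ∀ i → R i ≤ D
  R≤D i = ≤-trans (m≤n+m (R i) (L i + A i)) (≤-reflexive (deg-split G c v i))

  chain-at-v : ∀ i → 1 ≤ A i → 4 ≤ D ⊎ 2 ≤ L i ⊎ 2 ≤ R i
  chain-at-v i 1≤A with chain-local-deg (isCD i) v≢r 1≤A
  ... | inj₁ 4≤L+A+R = inj₁ (subst (4 ≤_) (deg-split G c v i) 4≤L+A+R)
  ... | inj₂ 2≤L⊎2≤R = inj₂ 2≤L⊎2≤R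

  module _ (D≤3 : D ≤ 3) where

    L+A≤1 : ∀ i → L i ≤ 1 → L i + A i ≤ 1
    L+A≤1 i L≤1 with 1 ≤? A i
    ... | no A≱1 =
      ≤-trans (≤-reflexive (trans (cong (L i +_) (n≤0⇒n≡0 (≮⇒≥ A≱1))) (+-identityʳ (L i)))) L≤1
    ... | yes 1≤A with chain-at-v i 1≤A
    ...   | inj₁ 4≤D = contradiction (≤-trans 4≤D D≤3) (<⇒≱ ≤-refl)
    ...   | inj₂ (inj₁ 2≤L) = contradiction (≤-trans 2≤L L≤1) (<⇒≱ ≤-refl)
    ...   | inj₂ (inj₂ 2≤R) =
      +-cancelʳ-≤ 2 (L i + A i) 1
        (≤-trans (+-monoʳ-≤ (L i + A i) 2≤R) (≤-trans (≤-reflexive (deg-split G c v i)) D≤3))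

    degBelow-suc≤1 : ∀ {t} (i : Fin (suc m)) → toℕ i ≡ t →
                     degBelow G c v t ≤ 1 → degBelow G c v (suc t) ≤ 1
    degBelow-suc≤1 i refl L≤1 = subst (_≤ 1) (sym (degBelow-suc G c v i)) (L+A≤1 i L≤1)

    degBelow≤1 : ∀ t → t ≤ suc m → degBelow G c v t ≤ 1
    degBelow≤1 zero _ = subst (_≤ 1) (sym (degBelow-zero G c v)) z≤n
    degBelow≤1 (suc t) t<sm = degBelow-suc≤1 (fromℕ< t<sm) (toℕ-fromℕ< t<sm) (degBelow≤1 t (<⇒≤ t<sm))

    D≤1 : D ≤ 1
    D≤1 = subst (_≤ 1) (degBelow-all G c v) (degBelow≤1 (suc m) ≤-refl)

    no-chain-at-v : ∀ i → 1 ≤ A i → ⊥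
    no-chain-at-v i 1≤A with chain-at-v i 1≤A
    ... | inj₁ 4≤D = <⇒≱ ≤-refl (≤-trans 4≤D D≤3)
    ... | inj₂ (inj₁ 2≤L) = <⇒≱ ≤-refl (≤-trans 2≤L (≤-trans (L≤D i) D≤1))
    ... | inj₂ (inj₂ 2≤R) = <⇒≱ ≤-refl (≤-trans 2≤R (≤-trans (R≤D i) D≤1))

  4≤deg : NoIsolated G → 4 ≤ D
  4≤deg noIso = ≮⇒≥ λ D<4 →
    let (e , _ , e∋v) = noIso v
    in no-chain-at-v (s≤s⁻¹ D<4) (c e) (≤-trans (Joins⇒1≤mult G e∋v) (mult≤deg G (⌊⌋-refl (c e)) v))

lemma9 : (G : Graph) → NoIsolated G → (r : V G) (m : ℕ) (c : E G → Fin (suc m)) →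
           IsChainDecomposition G r m c →
           (v : V G) → v ≢ r → 4 ≤ deg G (allEdges G) v
lemma9 G noIso r m c isCD v v≢r = 4≤deg isCD v≢r noIso
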